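{- Let $\alpha=(\alpha_1,\dots,\alpha_m)$ be a weak composition of $n$ and $\delta=(\delta_1,\dots,\delta_m)$ a weak composition, and let $N\subseteq\mathcal{W}_{\alpha,\delta}$ be a necklace (an orbit under rotation). Let $g=\gcd(\alpha_1,\dots,\alpha_m,\delta_1,\dots,\delta_m)$. Then $\frac{n}{|N|}\mid g$.
   Context: A word of length $n$ is a sequence $w=w_1\cdots w_n$ of positive integers; its content is the sequence whose $j$-th entry is the number of $j$'s in $w$. $\mathrm{cdes}(w)=\#\{1\le i\le n:w_i>w_{i+1}\}$ with indices mod $n$ (empty word: $0$). For $i\ge0$, $w^{(i)}$ is the subsequence of letters $\le i$. For $w$ of content $\alpha$ with $m$ parts, $\mathrm{CDT}(w)=(\mathrm{cdes}(w^{(1)}),\mathrm{cdes}(w^{(2)})-\mathrm{cdes}(w^{(1)}),\dots,\mathrm{cdes}(w^{(m)})-\mathrm{cdes}(w^{(m-1)}))$. $\mathcal{W}_{\alpha,\delta}$ is the set of words with content $\alpha$ and $\mathrm{CDT}=\delta$. The cyclic group $C_n$ acts on words of length $n$ by rotation $w_1\cdots w_{n-1}w_n\mapsto w_nw_1\cdots w_{n-1}$; orbits are called necklaces. -}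

module Defs where

open import Data.Nat using (ℕ; zero; suc; _+_; _≤_; _<_; _<ᵇ_; _≟_; _≤?_)
open import Data.Nat.GCD using (gcd)
open import Data.Bool using (Bool; true; false; if_then_else_)
open import Data.List using (List; []; _∷_; _++_; [_]; length; filter; reverse; map; upTo; foldr; deduplicate)
open import Data.List.Relation.Unary.All using (All)
open import Data.List.Properties using (≡-dec)
open import Data.Vec using (Vec; lookup; toList)
open import Data.Fin using (Fin; toℕ)
open import Data.Product using (_×_)
open import Relation.Binary.PropositionalEquality using (_≡_)

-- A word is a list of natural numbers (letters are required to be positive
-- via the content condition below).
Word : Set
Word = List ℕ

count : ℕ → Word → ℕ
count k w = length (filter (λ x → x ≟ k) w)

des : Word → ℕ
des []           = 0
des (x ∷ [])     = 0
des (x ∷ y ∷ ys) = (if y <ᵇ x then 1 else 0) + des (y ∷ ys)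

-- cyclic descents: indices i in 1..n with w_i > w_{i+1}, indices mod n
cdes : Word → ℕ
cdes []       = 0
cdes (x ∷ xs) = des ((x ∷ xs) ++ [ x ])

restrict : ℕ → Word → Word
restrict i w = filter (λ x → x ≤? i) w

HasContent : ∀ {m} → Vec ℕ m → Word → Set
HasContent {m} α w =
  All (λ x → (1 ≤ x) × (x ≤ m)) w × ((j : Fin m) → count (suc (toℕ j)) w ≡ lookup α j)

HasCDT : ∀ {m} → Vec ℕ m → Word → Set
HasCDT {m} δ w =
  (j : Fin m) → cdes (restrict (suc (toℕ j)) w) ≡ cdes (restrict (toℕ j) w) + lookup δ j

InW : ∀ {m} → Vec ℕ m → Vec ℕ m → Word → Set
InW α δ w = HasContent α w × HasCDT δ w

rot : Word → Word
rot w with reverse w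
... | []     = []
... | y ∷ ys = y ∷ reverse ys

rotN : ℕ → Word → Word
rotN zero    w = w
rotN (suc k) w = rot (rotN k w)

orbit : Word → List Word
orbit w = deduplicate (≡-dec _≟_) (map (λ k → rotN k w) (upTo (length w)))

orbitSize : Word → ℕ
orbitSize w = length (orbit w)

gcdAll : ∀ {m} → Vec ℕ m → Vec ℕ m → ℕ
gcdAll α δ = foldr gcd 0 (toList α ++ toList δ)

module Submission where

-- Let N be the necklace of w, n = |w| and q * |N| = n.  The idea is that
-- w is then a q-th power B^q (B repeated q times); counting letters and
-- cyclic descents is multiplicative on powers, so q divides every entry
-- of the content α and of the cyclic descent type δ, hence divides g.

open import Defs
open import Data.Nat using (ℕ; zero; suc; _*_; _+_; _∸_; _≤_; _<_; _≟_; _≤?_; _<ᵇ_; z≤n; s≤s; s≤s⁻¹; NonZero; >-nonZero; _%_; _/_)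
open import Data.Nat.Properties
open import Data.Nat.DivMod using (m≡m%n+[m/n]*n; m%n<n)
open import Data.Nat.Divisibility using (_∣_; m∣m*n; ∣m+n∣m⇒∣n; _∣0)
open import Data.Nat.GCD using (gcd; gcd-greatest)
open import Data.Bool using (if_then_else_)
open import Data.Vec using (Vec; lookup; toList)
import Data.Vec.Relation.Unary.All.Properties as VecAll
open import Data.Fin using (toℕ)
open import Data.List using (List; []; _∷_; _++_; [_]; length; filter; reverse; applyUpTo; foldr)
open import Data.List.Properties using (++-assoc; ++-identityʳ; filter-++; length-++; reverse-++; reverse-involutive; reverse-injective; ∷-injective; map-upTo; length-applyUpTo; ≡-dec)
open import Data.List.Relation.Unary.All using (All; []; _∷_)
import Data.List.Relation.Unary.All.Properties as ListAll
open import Data.List.Membership.Propositional using (_∈_)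
open import Data.List.Membership.Propositional.Properties using (∈-applyUpTo⁺; ∈-applyUpTo⁻; deduplicate-∈⇔)
open import Data.List.Membership.Propositional.Properties.WithK using (unique∧set⇒bag)
open import Data.List.Relation.Unary.Unique.Propositional using (Unique)
open import Data.List.Relation.Unary.Unique.Propositional.Properties using (applyUpTo⁺₁)
open import Data.List.Relation.Unary.Unique.DecPropositional.Properties using (deduplicate-!)
open import Data.List.Relation.Binary.BagAndSetEquality using (∼bag⇒↭)
open import Data.List.Relation.Binary.Permutation.Propositional.Properties using (↭-length)
open import Data.Product using (∃; ∃₂; _×_; _,_)
open import Data.Sum using (inj₁; inj₂)
open import Function using (_∘_; _⇔_; mk⇔; Equivalence)
open import Function.Properties.Equivalence using () renaming (trans to ⇔-trans)
open import Relation.Nullary using (¬_; yes; no)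
open import Relation.Unary using (Decidable)
open import Relation.Binary.PropositionalEquality using (_≡_; _≢_; refl; sym; trans; cong; cong₂; subst; module ≡-Reasoning)

pow : {A : Set} → ℕ → List A → List A
pow zero    v = []
pow (suc k) v = v ++ pow k v

pow-[] : {A : Set} (k : ℕ) → pow {A} k [] ≡ []
pow-[] zero    = refl
pow-[] (suc k) = pow-[] k

length-pow : {A : Set} (k : ℕ) (v : List A) → length (pow k v) ≡ k * length v
length-pow zero    v = refl
length-pow (suc k) v = trans (length-++ v) (cong (length v +_) (length-pow k v))

filter-pow : {A : Set} {P : A → Set} (P? : Decidable P) (k : ℕ) (v : List A) →
             filter P? (pow k v) ≡ pow k (filter P? v)
filter-pow P? zero    v = refl
filter-pow P? (suc k) v = trans (filter-++ P? v (pow k v)) (cong (filter P? v ++_) (filter-pow P? k v))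

count-pow : (j k : ℕ) (v : Word) → count j (pow k v) ≡ k * count j v
count-pow j k v = trans (cong length (filter-pow (_≟ j) k v)) (length-pow k _)

pow-conj : (k x : ℕ) (xs : Word) → pow k (x ∷ xs) ++ [ x ] ≡ x ∷ pow k (xs ++ [ x ])
pow-conj zero    x xs = refl
pow-conj (suc k) x xs = cong (x ∷_) (begin
    (xs ++ pow k (x ∷ xs)) ++ [ x ]   ≡⟨ ++-assoc xs _ [ x ] ⟩
    xs ++ (pow k (x ∷ xs) ++ [ x ])   ≡⟨ cong (xs ++_) (pow-conj k x xs) ⟩
    xs ++ x ∷ pow k (xs ++ [ x ])     ≡⟨ ++-assoc xs [ x ] _ ⟨
    (xs ++ [ x ]) ++ pow k (xs ++ [ x ]) ∎)
  where open ≡-Reasoning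

des-split : (u : Word) (y : ℕ) (z : Word) → des (u ++ y ∷ z) ≡ des (u ++ [ y ]) + des (y ∷ z)
des-split []          y z = refl
des-split (a ∷ [])    y z = sym (cong (_+ des (y ∷ z)) (+-identityʳ (if y <ᵇ a then 1 else 0)))
des-split (a ∷ b ∷ u) y z =
  trans (cong ((if b <ᵇ a then 1 else 0) +_) (des-split (b ∷ u) y z))
        (sym (+-assoc (if b <ᵇ a then 1 else 0) _ _))

cdes-pow : (k : ℕ) (v : Word) → cdes (pow k v) ≡ k * cdes v
cdes-pow k       []       = trans (cong cdes (pow-[] k)) (sym (*-zeroʳ k))
cdes-pow zero    (x ∷ xs) = refl
cdes-pow (suc k) (x ∷ xs) = des-pow-snoc (suc k)
  where
  v = x ∷ xs
  open ≡-Reasoning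
  des-pow-snoc : ∀ k → des (pow k v ++ [ x ]) ≡ k * cdes v
  des-pow-snoc zero    = refl
  des-pow-snoc (suc k) = begin
    des ((v ++ pow k v) ++ [ x ])          ≡⟨ cong des (++-assoc v (pow k v) [ x ]) ⟩
    des (v ++ (pow k v ++ [ x ]))          ≡⟨ cong (λ t → des (v ++ t)) (pow-conj k x xs) ⟩
    des (v ++ x ∷ pow k (xs ++ [ x ]))     ≡⟨ des-split v x _ ⟩
    cdes v + des (x ∷ pow k (xs ++ [ x ])) ≡⟨ cong (λ t → cdes v + des t) (pow-conj k x xs) ⟨
    cdes v + des (pow k v ++ [ x ])        ≡⟨ cong (cdes v +_) (des-pow-snoc k) ⟩
    cdes v + k * cdes v                    ∎

rot-snoc : (xs : Word) (y : ℕ) → rot (xs ++ [ y ]) ≡ y ∷ xs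
rot-snoc xs y rewrite reverse-++ xs [ y ] | reverse-involutive xs = refl

rot-injective : {u v : Word} → rot u ≡ rot v → u ≡ v
rot-injective {u} {v} e with reverse u in ru | reverse v in rv
rot-injective e | []     | []      = reverse-injective (trans ru (sym rv))
rot-injective e | y ∷ ys | y′ ∷ ys′ with refl , e′ ← ∷-injective e =
  reverse-injective (trans ru (trans (cong (y ∷_) (reverse-injective e′)) (sym rv)))

rotN-injective : (k : ℕ) {u v : Word} → rotN k u ≡ rotN k v → u ≡ v
rotN-injective zero    e = e
rotN-injective (suc k) e = rotN-injective k (rot-injective e)

rotN-+ : (a b : ℕ) (w : Word) → rotN (a + b) w ≡ rotN a (rotN b w)
rotN-+ zero    b w = refl
rotN-+ (suc a) b w = cong rot (rotN-+ a b w)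

rotN-swap : (A B : Word) → rotN (length B) (A ++ B) ≡ B ++ A
rotN-swap A []      = ++-identityʳ A
rotN-swap A (b ∷ B) = begin
    rot (rotN (length B) (A ++ b ∷ B))       ≡⟨ cong (rot ∘ rotN (length B)) (++-assoc A [ b ] B) ⟨
    rot (rotN (length B) ((A ++ [ b ]) ++ B)) ≡⟨ cong rot (rotN-swap (A ++ [ b ]) B) ⟩
    rot (B ++ A ++ [ b ])                     ≡⟨ cong rot (++-assoc B A [ b ]) ⟨
    rot ((B ++ A) ++ [ b ])                   ≡⟨ rot-snoc (B ++ A) b ⟩
    b ∷ B ++ A                                ∎
  where open ≡-Reasoning

rotN-length : (w : Word) → rotN (length w) w ≡ w
rotN-length w = trans (rotN-swap [] w) (++-identityʳ w)

least-witness : {P : ℕ → Set} → Decidable P → {n : ℕ} → P n →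
                ∃ λ j → P j × (∀ {i} → i < j → ¬ P i)
least-witness {P} P? {n} Pn = scan 0 n refl (λ ())
  where
  scan : ∀ i fuel → i + fuel ≡ n → (∀ {l} → l < i → ¬ P l) → ∃ λ j → P j × (∀ {l} → l < j → ¬ P l)
  scan i zero        e below = i , subst P (trans (sym e) (+-identityʳ i)) Pn , below
  scan i (suc fuel) e below with P? i
  ... | yes Pi  = i , Pi , below
  ... | no  ¬Pi = scan (suc i) fuel (trans (sym (+-suc i fuel)) e) below′
    where
    below′ : ∀ {l} → l < suc i → ¬ P l
    below′ l<1+i with m≤n⇒m<n∨m≡n (s≤s⁻¹ l<1+i)
    ... | inj₁ l<i  = below l<i
    ... | inj₂ refl = ¬Pi

unique-set-length : {A : Set} {xs ys : List A} → Unique xs → Unique ys →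
                    (∀ {x} → x ∈ xs ⇔ x ∈ ys) → length xs ≡ length ys
unique-set-length uxs uys same = ↭-length (∼bag⇒↭ (unique∧set⇒bag uxs uys same))

applyUpTo-periodic : {A : Set} (f : ℕ → A) {p n : ℕ} .{{_ : NonZero p}} →
                     (∀ k → f k ≡ f (k % p)) → p ≤ n →
                     ∀ {x} → x ∈ applyUpTo f n ⇔ x ∈ applyUpTo f p
applyUpTo-periodic f {p} periodic p≤n = mk⇔ to from
  where
  to : ∀ {x} → x ∈ applyUpTo f _ → x ∈ applyUpTo f p
  to x∈ with k , _ , refl ← ∈-applyUpTo⁻ f x∈ =
    subst (_∈ applyUpTo f p) (sym (periodic k)) (∈-applyUpTo⁺ f (m%n<n k p))
  from : ∀ {x} → x ∈ applyUpTo f p → x ∈ applyUpTo f _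
  from x∈ with i , i<p , refl ← ∈-applyUpTo⁻ f x∈ = ∈-applyUpTo⁺ f (<-≤-trans i<p p≤n)

∈-orbit⇔ : (w : Word) → ∀ {x} → x ∈ orbit w ⇔ x ∈ applyUpTo (λ k → rotN k w) (length w)
∈-orbit⇔ w {x} = mk⇔
  (λ x∈ → subst (x ∈_) (map-upTo r n) (Equivalence.from (deduplicate-∈⇔ (≡-dec _≟_)) x∈))
  (λ x∈ → Equivalence.to (deduplicate-∈⇔ (≡-dec _≟_)) (subst (x ∈_) (sym (map-upTo r n)) x∈))
  where
  r : ℕ → Word
  r k = rotN k w
  n = length w

rotN-multiple : {w : Word} {p : ℕ} → rotN p w ≡ w → ∀ t → rotN (t * p) w ≡ w
rotN-multiple         period zero    = refl
rotN-multiple {w} {p} period (suc t) =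
  trans (rotN-+ p (t * p) w) (trans (cong (rotN p) (rotN-multiple period t)) period)

rotN-mod : {w : Word} {p : ℕ} .{{_ : NonZero p}} → rotN p w ≡ w → ∀ k → rotN k w ≡ rotN (k % p) w
rotN-mod {w} {p} period k = begin
  rotN k w                               ≡⟨ cong (λ t → rotN t w) (m≡m%n+[m/n]*n k p) ⟩
  rotN (k % p + (k / p) * p) w           ≡⟨ rotN-+ (k % p) ((k / p) * p) w ⟩
  rotN (k % p) (rotN ((k / p) * p) w)    ≡⟨ cong (rotN (k % p)) (rotN-multiple period (k / p)) ⟩
  rotN (k % p) w                         ∎
  where open ≡-Reasoning

IsLeastPeriod : Word → ℕ → Set
IsLeastPeriod w p = 0 < p × rotN p w ≡ w × (∀ {i} → 0 < i → i < p → rotN i w ≢ w)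

-- A nonempty word has a least period (|w| itself is a period).
least-period : (w : Word) → 0 < length w → ∃ (IsLeastPeriod w)
least-period w 0<n = from-least (least-witness (λ j → ≡-dec _≟_ (rotN (suc j) w) w) {length w ∸ 1} full-turn)
  where
  from-least : (∃ λ j → rotN (suc j) w ≡ w × (∀ {i} → i < j → rotN (suc i) w ≢ w)) → ∃ (IsLeastPeriod w)
  from-least (j , period , least) = suc j , s≤s z≤n , period , λ { {suc i} _ (s≤s i<j) → least i<j }
  full-turn : rotN (suc (length w ∸ 1)) w ≡ w
  full-turn = trans (cong (λ t → rotN t w) (m+[n∸m]≡n 0<n)) (rotN-length w)

least-period-≤-length : {w : Word} {p : ℕ} → IsLeastPeriod w p → 0 < length w → p ≤ length w
least-period-≤-length {w} (_ , _ , least) 0<n = ≮⇒≥ (λ n<p → least 0<n n<p (rotN-length w))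

rotations-distinct : {w : Word} {p : ℕ} → IsLeastPeriod w p →
                     ∀ {i k} → i < k → k < p → rotN i w ≢ rotN k w
rotations-distinct {w} (_ , _ , least) {i} {k} i<k k<p same =
  least (m<n⇒0<n∸m i<k) (≤-<-trans (m∸n≤m k i) k<p) (sym (rotN-injective i shifted))
  where
  shifted : rotN i w ≡ rotN i (rotN (k ∸ i) w)
  shifted = trans same (trans (cong (λ t → rotN t w) (sym (m+[n∸m]≡n (<⇒≤ i<k)))) (rotN-+ i (k ∸ i) w))

orbitSize-least-period : {w : Word} {p : ℕ} → IsLeastPeriod w p → 0 < length w → orbitSize w ≡ p
orbitSize-least-period {w} {p} lp@(0<p , period , _) 0<n =
  trans (unique-set-length (deduplicate-! (≡-dec _≟_) _) (applyUpTo⁺₁ r p (rotations-distinct lp)) same-members)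
        (length-applyUpTo r p)
  where
  instance _ = >-nonZero 0<p
  r : ℕ → Word
  r k = rotN k w
  same-members : ∀ {x} → x ∈ orbit w ⇔ x ∈ applyUpTo r p
  same-members = ⇔-trans (∈-orbit⇔ w) (applyUpTo-periodic r (rotN-mod period) (least-period-≤-length lp 0<n))

rotN-orbitSize : (w : Word) → rotN (orbitSize w) w ≡ w
rotN-orbitSize []       = refl
rotN-orbitSize (x ∷ xs) with p , lp@(_ , period , _) ← least-period (x ∷ xs) (s≤s z≤n) =
  trans (cong (λ t → rotN t (x ∷ xs)) (orbitSize-least-period lp (s≤s z≤n))) period

split-at : {A : Set} (a b : ℕ) (w : List A) → length w ≡ a + b →
           ∃₂ λ X Y → w ≡ X ++ Y × length X ≡ a × length Y ≡ b
split-at zero    b w       e = [] , w , refl , refl , e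
split-at (suc a) b (x ∷ w) e with X , Y , refl , refl , refl ← split-at a b w (suc-injective e) =
  x ∷ X , Y , refl , refl , refl

++-cancel-prefix : {A : Set} (X U : List A) {Y V : List A} → length X ≡ length U →
                   X ++ Y ≡ U ++ V → X ≡ U × Y ≡ V
++-cancel-prefix []      []      _ e = refl , e
++-cancel-prefix (x ∷ X) (u ∷ U) l e with refl , e′ ← ∷-injective e
                                      with refl , Y≡V ← ++-cancel-prefix X U (suc-injective l) e′ =
  refl , Y≡V

commuting-power : (k : ℕ) (A B : Word) → A ++ B ≡ B ++ A → length A ≡ k * length B → A ≡ pow k B
commuting-power zero    []  B _    _ = refl
commuting-power (suc k) A   B comm lA
  with A₁ , A₂ , refl , lA₁ , lA₂ ← split-at (length B) (k * length B) A lA =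
  cong₂ _++_ A₁≡B (commuting-power k A₂ B A₂-comm lA₂)
  where
  -- comparing the first |B| letters of A₁ (A₂ B) = B (A₁ A₂)
  cut : A₁ ≡ B × A₂ ++ B ≡ A₁ ++ A₂
  cut = ++-cancel-prefix A₁ B lA₁ (trans (sym (++-assoc A₁ A₂ B)) comm)
  A₁≡B : A₁ ≡ B
  A₁≡B with refl , _ ← cut = refl
  A₂-comm : A₂ ++ B ≡ B ++ A₂
  A₂-comm with refl , e ← cut = e

periodic-power : {w : Word} {p q : ℕ} → rotN p w ≡ w → q * p ≡ length w → ∃ λ B → w ≡ pow q B
periodic-power {[]}    {q = zero}  _      _ = [] , refl
periodic-power {w} {p} {suc k} period e
  with A , B , refl , lA , refl ← split-at (k * p) p w (trans (sym e) (+-comm p (k * p))) =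
  B , (begin
    A ++ B            ≡⟨ comm ⟩
    B ++ A            ≡⟨ cong (B ++_) (commuting-power k A B comm lA) ⟩
    B ++ pow k B      ∎)
  where
  open ≡-Reasoning
  comm : A ++ B ≡ B ++ A
  comm = trans (sym period) (rotN-swap A B)

gcd-list-greatest : {q : ℕ} (xs : List ℕ) → All (q ∣_) xs → q ∣ foldr gcd 0 xs
gcd-list-greatest []       []           = _ ∣0
gcd-list-greatest (x ∷ xs) (q∣x ∷ q∣xs) = gcd-greatest q∣x (gcd-list-greatest xs q∣xs)

gcdAll-greatest : {m q : ℕ} (α δ : Vec ℕ m) → (∀ j → q ∣ lookup α j) → (∀ j → q ∣ lookup δ j) →
                  q ∣ gcdAll α δ
gcdAll-greatest α δ q∣α q∣δ = gcd-list-greatest (toList α ++ toList δ)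
  (ListAll.++⁺ (VecAll.toList⁺ (VecAll.lookup⁻ {xs = α} q∣α)) (VecAll.toList⁺ (VecAll.lookup⁻ {xs = δ} q∣δ)))

∣-difference : (q a b d : ℕ) → q * a ≡ q * b + d → q ∣ d
∣-difference q a b d e = ∣m+n∣m⇒∣n (subst (q ∣_) e (m∣m*n a)) (m∣m*n b)

lemma4p4 : (m : ℕ) (α δ : Vec ℕ m) (w : Word) → InW α δ w →
    (q : ℕ) → q * orbitSize w ≡ length w → q ∣ gcdAll α δ
lemma4p4 m α δ w ((_ , content) , cdt) q e with B , refl ← periodic-power {q = q} (rotN-orbitSize w) e =
  gcdAll-greatest α δ q∣α q∣δ
  where
  cdes-restrict : ∀ i → cdes (restrict i (pow q B)) ≡ q * cdes (restrict i B)
  cdes-restrict i = trans (cong cdes (filter-pow (_≤? i) q B)) (cdes-pow q _)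
  q∣α : ∀ j → q ∣ lookup α j
  q∣α j = subst (q ∣_) (trans (sym (count-pow (suc (toℕ j)) q B)) (content j)) (m∣m*n _)
  q∣δ : ∀ j → q ∣ lookup δ j
  q∣δ j = ∣-difference q _ _ _
    (trans (sym (cdes-restrict (suc (toℕ j)))) (trans (cdt j) (cong (_+ lookup δ j) (cdes-restrict (toℕ j)))))
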